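{- For all integers $n,p\ge0$, \[ B_{n+1,\lambda}^{(p)}(x)=(x-n\lambda)B_{n,\lambda}^{(p)}(x)-\sum_{j=0}^{n}\binom{n}{j}(1)_{n-j,\lambda}\Big(\frac{p}{p+1}B_{j,\lambda}^{(p+1)}(x)-B_{j,\lambda}^{(p)}(x)\Big). \]
   Context: Let $\lambda\in\mathbb{R}$. Set $(x)_{0,\lambda}=1$, $(x)_{n,\lambda}=x(x-\lambda)\cdots(x-(n-1)\lambda)$ for $n\ge1$. The degenerate exponential is the formal power series $e_\lambda^x(t)=\sum_{n\ge0}(x)_{n,\lambda}\frac{t^n}{n!}$ ($=(1+\lambda t)^{x/\lambda}$, and $e^{xt}$ if $\lambda=0$), $e_\lambda(t)=e_\lambda^1(t)$. For an integer $p\ge0$, the truncated degenerate modified Bell polynomials $B^{(p)}_{n,\lambda}(x)$ are defined by \[\frac{p!}{(e_\lambda(t)-1)^p}\Big(e^{e_\lambda(t)-1}-\sum_{l=0}^{p-1}\frac{(e_\lambda(t)-1)^l}{l!}\Big)e_\lambda^x(t)=\sum_{n\ge0}B^{(p)}_{n,\lambda}(x)\frac{t^n}{n!},\] where the left side is, as a formal power series, $p!\sum_{k\ge0}\frac{(e_\lambda(t)-1)^k}{(k+p)!}e_\lambda^x(t)$.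
   Formalization: The parameter λ ranges over the rationals rather than the reals, and the argument x is rational as well. -}

module Defs where

open import Data.Nat as ℕ using (ℕ; zero; suc; _∸_; _!)
open import Data.Nat.Properties using (_!≢0)
open import Data.Integer using (+_)
open import Data.Rational using (ℚ; 0ℚ; 1ℚ; _+_; _*_; _-_; _/_)

ℕ→ℚ : ℕ → ℚ
ℕ→ℚ n = (+ n) / 1

sumTo : (ℕ → ℚ) → ℕ → ℚ
sumTo f zero    = f 0
sumTo f (suc n) = sumTo f n + f (suc n)

fallingλ : ℚ → ℚ → ℕ → ℚ
fallingλ lam x zero    = 1ℚ
fallingλ lam x (suc n) = fallingλ lam x n * (x - ℕ→ℚ n * lam)

inv! : ℕ → ℚ
inv! n = (+ 1) / (n !)
  where instance _ = n !≢0

-- formal power series in t, given by ordinary coefficients: s n = [t^n] s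
Series : Set
Series = ℕ → ℚ

_⊛_ : Series → Series → Series
(a ⊛ b) n = sumTo (λ i → a i * b (n ∸ i)) n

one : Series
one zero    = 1ℚ
one (suc n) = 0ℚ

pow : Series → ℕ → Series
pow s zero    = one
pow s (suc k) = pow s k ⊛ s

eλx : ℚ → ℚ → Series
eλx lam x n = fallingλ lam x n * inv! n

eλ-1 : ℚ → Series
eλ-1 lam zero    = 0ℚ
eλ-1 lam (suc n) = eλx lam 1ℚ (suc n)

-- truncated degenerate modified Bell polynomial B^{(p)}_{n,λ}(x):
-- n! [t^n] ( p! Σ_{k≥0} (e_λ(t)-1)^k/(k+p)! · e_λ^x(t) ).
-- Since (e_λ(t)-1)^k has no terms below t^k, only k ≤ n contribute to [t^n].
bellSeries : ℕ → ℚ → ℚ → Series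
bellSeries p lam x n =
  sumTo (λ k → (ℕ→ℚ (p !) * inv! (k ℕ.+ p)) * (pow (eλ-1 lam) k ⊛ eλx lam x) n) n

B : ℕ → ℕ → ℚ → ℚ → ℚ
B p n lam x = ℕ→ℚ (n !) * bellSeries p lam x n

-- Let F_p(t) = Σ_n B^{(p)}_{n,λ}(x) t^n/n! = f_p(e_λ(t) - 1) e_λ^x(t), where
-- f_p(u) = p! Σ_k u^k/(k+p)!, and let ∂ = (1 + λt) d/dt.  Since ∂ e_λ^y = y e_λ^y,
-- we get ∂(e_λ(t) - 1) = e_λ(t), and the chain rule gives ∂ f(e_λ(t) - 1) =
-- f′(e_λ(t) - 1) e_λ(t).  The truncated exponential satisfies
-- f_p′ = f_p - p/(p+1) f_{p+1}, so by the Leibniz rule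
--   ∂F_p = x F_p + (F_p - p/(p+1) F_{p+1}) e_λ(t).
-- Taking n! times the coefficient of t^n gives B_{n+1} + nλ B_n on the left, and
-- multiplying by e_λ(t) = Σ_m (1)_{m,λ} t^m/m! produces the binomial sum on the right.

module Submission where

open import Defs
open import Data.Nat using (ℕ; suc; _∸_)
open import Data.Nat.Combinatorics using (_C_)
open import Data.Integer using (+_)
open import Data.Rational using (ℚ; 1ℚ; _+_; _*_; _-_; _/_)
open import Relation.Binary.PropositionalEquality using (_≡_)

open import Data.Nat as ℕ using (zero; _!; _≤_; _<_; z≤n; s≤s; NonZero)
import Data.Nat.Properties as ℕₚ
open import Data.Nat.Combinatorics using (nCk≡n!/k![n-k]!; k![n∸k]!∣n!)
open import Data.Nat.DivMod using (m/n*n≡m)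
import Data.Integer as ℤ
import Data.Integer.Properties as ℤₚ
open import Data.Rational using (0ℚ; -_; toℚᵘ)
import Data.Rational.Properties as ℚₚ
open import Data.Rational.Solver using (module +-*-Solver)
open import Data.Rational.Unnormalised as ℚᵘ using (mkℚᵘ; *≡*)
import Data.Rational.Unnormalised.Properties as ℚᵘₚ
open import Data.Sum using (inj₁; inj₂)
open import Function using (_∘_)
open import Relation.Binary.PropositionalEquality
  using (refl; sym; trans; cong; cong₂; subst; _≗_; module ≡-Reasoning)
open import Relation.Nullary using (yes; no)

open +-*-Solver using (solve; _:=_; _:+_; _:-_; _:*_; :-_; con)

toℚᵘ-ℕ→ℚ : ∀ n → toℚᵘ (ℕ→ℚ n) ℚᵘ.≃ mkℚᵘ (+ n) 0
toℚᵘ-ℕ→ℚ n = ℚₚ.toℚᵘ-fromℚᵘ (mkℚᵘ (+ n) 0)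

ℕ→ℚ-+ : ∀ m n → ℕ→ℚ (m ℕ.+ n) ≡ ℕ→ℚ m + ℕ→ℚ n
ℕ→ℚ-+ m n = ℚₚ.toℚᵘ-injective (begin
  toℚᵘ (ℕ→ℚ (m ℕ.+ n))
    ≈⟨ toℚᵘ-ℕ→ℚ (m ℕ.+ n) ⟩
  mkℚᵘ (+ (m ℕ.+ n)) 0
    ≡⟨ cong (λ i → mkℚᵘ i 0) numerator ⟩
  mkℚᵘ (+ m) 0 ℚᵘ.+ mkℚᵘ (+ n) 0
    ≈⟨ ℚᵘₚ.+-cong (ℚᵘₚ.≃-sym (toℚᵘ-ℕ→ℚ m)) (ℚᵘₚ.≃-sym (toℚᵘ-ℕ→ℚ n)) ⟩
  toℚᵘ (ℕ→ℚ m) ℚᵘ.+ toℚᵘ (ℕ→ℚ n)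
    ≈⟨ ℚᵘₚ.≃-sym (ℚₚ.toℚᵘ-homo-+ (ℕ→ℚ m) (ℕ→ℚ n)) ⟩
  toℚᵘ (ℕ→ℚ m + ℕ→ℚ n)
    ∎)
  where
  open ℚᵘₚ.≃-Reasoning
  numerator : + (m ℕ.+ n) ≡ + m ℤ.* + 1 ℤ.+ + n ℤ.* + 1
  numerator = trans (ℤₚ.pos-+ m n)
    (sym (cong₂ ℤ._+_ (ℤₚ.*-identityʳ (+ m)) (ℤₚ.*-identityʳ (+ n))))

ℕ→ℚ-* : ∀ m n → ℕ→ℚ (m ℕ.* n) ≡ ℕ→ℚ m * ℕ→ℚ n
ℕ→ℚ-* m n = ℚₚ.toℚᵘ-injective (begin
  toℚᵘ (ℕ→ℚ (m ℕ.* n))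
    ≈⟨ toℚᵘ-ℕ→ℚ (m ℕ.* n) ⟩
  mkℚᵘ (+ (m ℕ.* n)) 0
    ≡⟨ cong (λ i → mkℚᵘ i 0) (ℤₚ.pos-* m n) ⟩
  mkℚᵘ (+ m) 0 ℚᵘ.* mkℚᵘ (+ n) 0
    ≈⟨ ℚᵘₚ.*-cong (ℚᵘₚ.≃-sym (toℚᵘ-ℕ→ℚ m)) (ℚᵘₚ.≃-sym (toℚᵘ-ℕ→ℚ n)) ⟩
  toℚᵘ (ℕ→ℚ m) ℚᵘ.* toℚᵘ (ℕ→ℚ n)
    ≈⟨ ℚᵘₚ.≃-sym (ℚₚ.toℚᵘ-homo-* (ℕ→ℚ m) (ℕ→ℚ n)) ⟩
  toℚᵘ (ℕ→ℚ m * ℕ→ℚ n)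
    ∎)
  where open ℚᵘₚ.≃-Reasoning

/-*-cancel : ∀ m n .{{_ : NonZero n}} → ((+ m) / n) * ℕ→ℚ n ≡ ℕ→ℚ m
/-*-cancel m (suc d) = ℚₚ.toℚᵘ-injective (begin
  toℚᵘ ((+ m) / suc d * ℕ→ℚ (suc d))
    ≈⟨ ℚₚ.toℚᵘ-homo-* ((+ m) / suc d) (ℕ→ℚ (suc d)) ⟩
  toℚᵘ ((+ m) / suc d) ℚᵘ.* toℚᵘ (ℕ→ℚ (suc d))
    ≈⟨ ℚᵘₚ.*-cong (ℚₚ.toℚᵘ-fromℚᵘ (mkℚᵘ (+ m) d)) (toℚᵘ-ℕ→ℚ (suc d)) ⟩
  mkℚᵘ (+ m) d ℚᵘ.* mkℚᵘ (+ suc d) 0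
    ≈⟨ *≡* cross ⟩
  mkℚᵘ (+ m) 0
    ≈⟨ ℚᵘₚ.≃-sym (toℚᵘ-ℕ→ℚ m) ⟩
  toℚᵘ (ℕ→ℚ m)
    ∎)
  where
  open ℚᵘₚ.≃-Reasoning
  cross : (+ m ℤ.* + suc d) ℤ.* + 1 ≡ + m ℤ.* + suc (d ℕ.* 1)
  cross = trans (ℤₚ.*-identityʳ _) (cong (λ k → + m ℤ.* + suc k) (sym (ℕₚ.*-identityʳ d)))

inv!-inverse : ∀ n → inv! n * ℕ→ℚ (n !) ≡ 1ℚ
inv!-inverse n = /-*-cancel 1 (n !) {{n ℕₚ.!≢0}}

inv!-suc : ∀ n → ℕ→ℚ (suc n) * inv! (suc n) ≡ inv! n
inv!-suc n = begin
  S * I′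
    ≡⟨ sym (ℚₚ.*-identityʳ (S * I′)) ⟩
  S * I′ * 1ℚ
    ≡⟨ cong (λ u → S * I′ * u) (sym (inv!-inverse n)) ⟩
  S * I′ * (I * ℕ→ℚ (n !))
    ≡⟨ solve 4 (λ s i′ i f → s :* i′ :* (i :* f) := i′ :* (s :* f) :* i) refl S I′ I (ℕ→ℚ (n !)) ⟩
  I′ * (S * ℕ→ℚ (n !)) * I
    ≡⟨ cong (λ f → I′ * f * I) (sym (ℕ→ℚ-* (suc n) (n !))) ⟩
  I′ * ℕ→ℚ (suc n !) * I
    ≡⟨ cong (_* I) (inv!-inverse (suc n)) ⟩
  1ℚ * I
    ≡⟨ ℚₚ.*-identityˡ I ⟩
  I
    ∎
  where
  open ≡-Reasoning
  S  = ℕ→ℚ (suc n)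
  I  = inv! n
  I′ = inv! (suc n)

binomial-ℕ→ℚ : ∀ {n j} → j ≤ n → ℕ→ℚ (n C j) * (ℕ→ℚ (j !) * ℕ→ℚ ((n ∸ j) !)) ≡ ℕ→ℚ (n !)
binomial-ℕ→ℚ {n} {j} j≤n = begin
  ℕ→ℚ (n C j) * (ℕ→ℚ (j !) * ℕ→ℚ ((n ∸ j) !))
    ≡⟨ cong (ℕ→ℚ (n C j) *_) (sym (ℕ→ℚ-* (j !) ((n ∸ j) !))) ⟩
  ℕ→ℚ (n C j) * ℕ→ℚ (j ! ℕ.* (n ∸ j) !)
    ≡⟨ sym (ℕ→ℚ-* (n C j) _) ⟩
  ℕ→ℚ ((n C j) ℕ.* (j ! ℕ.* (n ∸ j) !))
    ≡⟨ cong ℕ→ℚ nCk*k![n∸k]!≡n! ⟩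
  ℕ→ℚ (n !)
    ∎
  where
  open ≡-Reasoning
  nCk*k![n∸k]!≡n! : (n C j) ℕ.* (j ! ℕ.* (n ∸ j) !) ≡ n !
  nCk*k![n∸k]!≡n! = trans (cong (ℕ._* (j ! ℕ.* (n ∸ j) !)) (nCk≡n!/k![n-k]! j≤n))
                          (m/n*n≡m {{j ℕₚ.!* (n ∸ j) !≢0}} (k![n∸k]!∣n! j≤n))

sumTo-cong≤ : ∀ {f g : ℕ → ℚ} n → (∀ i → i ≤ n → f i ≡ g i) → sumTo f n ≡ sumTo g n
sumTo-cong≤ zero    f≡g = f≡g 0 z≤n
sumTo-cong≤ (suc n) f≡g =
  cong₂ _+_ (sumTo-cong≤ n (λ i i≤n → f≡g i (ℕₚ.m≤n⇒m≤1+n i≤n))) (f≡g (suc n) ℕₚ.≤-refl)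

sumTo-cong : ∀ {f g : ℕ → ℚ} n → f ≗ g → sumTo f n ≡ sumTo g n
sumTo-cong n f≗g = sumTo-cong≤ n (λ i _ → f≗g i)

sumTo-zero : ∀ {f : ℕ → ℚ} n → (∀ i → i ≤ n → f i ≡ 0ℚ) → sumTo f n ≡ 0ℚ
sumTo-zero zero    f≡0 = f≡0 0 z≤n
sumTo-zero (suc n) f≡0 = trans
  (cong₂ _+_ (sumTo-zero n (λ i i≤n → f≡0 i (ℕₚ.m≤n⇒m≤1+n i≤n))) (f≡0 (suc n) ℕₚ.≤-refl))
  (ℚₚ.+-identityˡ 0ℚ)

sumTo-distrib-+ : ∀ (f g : ℕ → ℚ) n → sumTo (λ i → f i + g i) n ≡ sumTo f n + sumTo g n
sumTo-distrib-+ f g zero    = refl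
sumTo-distrib-+ f g (suc n) = trans (cong (_+ (f (suc n) + g (suc n))) (sumTo-distrib-+ f g n))
  (solve 4 (λ a b c d → (a :+ b) :+ (c :+ d) := (a :+ c) :+ (b :+ d)) refl
     (sumTo f n) (sumTo g n) (f (suc n)) (g (suc n)))

sumTo-distrib-- : ∀ (f g : ℕ → ℚ) n → sumTo (λ i → f i - g i) n ≡ sumTo f n - sumTo g n
sumTo-distrib-- f g zero    = refl
sumTo-distrib-- f g (suc n) = trans (cong (_+ (f (suc n) - g (suc n))) (sumTo-distrib-- f g n))
  (solve 4 (λ a b c d → (a :- b) :+ (c :- d) := (a :+ c) :- (b :+ d)) refl
     (sumTo f n) (sumTo g n) (f (suc n)) (g (suc n)))

sumTo-neg : ∀ (f : ℕ → ℚ) n → sumTo (λ i → - f i) n ≡ - sumTo f n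
sumTo-neg f zero    = refl
sumTo-neg f (suc n) = trans (cong (_+ - f (suc n)) (sumTo-neg f n))
  (sym (ℚₚ.neg-distrib-+ (sumTo f n) (f (suc n))))

*-distribˡ-sumTo : ∀ c (f : ℕ → ℚ) n → c * sumTo f n ≡ sumTo (λ i → c * f i) n
*-distribˡ-sumTo c f zero    = refl
*-distribˡ-sumTo c f (suc n) =
  trans (ℚₚ.*-distribˡ-+ c (sumTo f n) (f (suc n))) (cong (_+ c * f (suc n)) (*-distribˡ-sumTo c f n))

*-distribʳ-sumTo : ∀ c (f : ℕ → ℚ) n → sumTo f n * c ≡ sumTo (λ i → f i * c) n
*-distribʳ-sumTo c f n = trans (ℚₚ.*-comm (sumTo f n) c)
  (trans (*-distribˡ-sumTo c f n) (sumTo-cong n (λ i → ℚₚ.*-comm c (f i))))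

sumTo-head : ∀ (f : ℕ → ℚ) n → sumTo f (suc n) ≡ f 0 + sumTo (f ∘ suc) n
sumTo-head f zero    = refl
sumTo-head f (suc n) = trans (cong (_+ f (suc (suc n))) (sumTo-head f n))
  (ℚₚ.+-assoc (f 0) (sumTo (f ∘ suc) n) (f (suc (suc n))))

sumTo-reverse : ∀ (f : ℕ → ℚ) n → sumTo f n ≡ sumTo (λ i → f (n ∸ i)) n
sumTo-reverse f zero    = refl
sumTo-reverse f (suc n) = begin
  sumTo f n + f (suc n)                          ≡⟨ cong (_+ f (suc n)) (sumTo-reverse f n) ⟩
  sumTo (λ i → f (n ∸ i)) n + f (suc n)          ≡⟨ ℚₚ.+-comm _ (f (suc n)) ⟩
  f (suc n) + sumTo (λ i → f (n ∸ i)) n          ≡⟨ sym (sumTo-head (λ i → f (suc n ∸ i)) n) ⟩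
  sumTo (λ i → f (suc n ∸ i)) (suc n)            ∎
  where open ≡-Reasoning

sumTo-swap : ∀ (F : ℕ → ℕ → ℚ) m n →
             sumTo (λ i → sumTo (F i) n) m ≡ sumTo (λ j → sumTo (λ i → F i j) m) n
sumTo-swap F zero    n = refl
sumTo-swap F (suc m) n = trans (cong (_+ sumTo (F (suc m)) n) (sumTo-swap F m n))
  (sym (sumTo-distrib-+ (λ j → sumTo (λ i → F i j) m) (F (suc m)) n))

sumTo-triangle : ∀ (F : ℕ → ℕ → ℚ) n →
  sumTo (λ i → sumTo (λ j → F j (i ∸ j)) i) n ≡ sumTo (λ j → sumTo (F j) (n ∸ j)) n
sumTo-triangle F zero    = refl
sumTo-triangle F (suc n) = begin
  L + (D + F (suc n) (n ∸ n))
    ≡⟨ cong₂ (λ u v → u + (D + F (suc n) v)) (sumTo-triangle F n) (ℕₚ.n∸n≡0 n) ⟩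
  R + (D + F (suc n) 0)
    ≡⟨ sym (ℚₚ.+-assoc R D (F (suc n) 0)) ⟩
  (R + D) + F (suc n) 0
    ≡⟨ cong₂ _+_ (sym (trans (sumTo-cong≤ n row) (sumTo-distrib-+ _ _ n)))
                 (cong (sumTo (F (suc n))) (sym (ℕₚ.n∸n≡0 n))) ⟩
  sumTo (λ j → sumTo (F j) (suc n ∸ j)) n + sumTo (F (suc n)) (n ∸ n)
    ∎
  where
  open ≡-Reasoning
  L = sumTo (λ i → sumTo (λ j → F j (i ∸ j)) i) n
  R = sumTo (λ j → sumTo (F j) (n ∸ j)) n
  D = sumTo (λ j → F j (suc n ∸ j)) n
  row : ∀ j → j ≤ n → sumTo (F j) (suc n ∸ j) ≡ sumTo (F j) (n ∸ j) + F j (suc n ∸ j)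
  row j j≤n rewrite ℕₚ.+-∸-assoc 1 j≤n = refl

sumTo-extend : ∀ (f : ℕ → ℚ) {n N} → n ≤ N → (∀ i → n < i → f i ≡ 0ℚ) → sumTo f N ≡ sumTo f n
sumTo-extend f {n} {zero}  z≤n  _   = refl
sumTo-extend f {n} {suc N} n≤1+N f≡0 with ℕₚ.m≤n⇒m<n∨m≡n n≤1+N
... | inj₂ refl = refl
... | inj₁ n<1+N = trans (cong₂ _+_ (sumTo-extend f (ℕₚ.≤-pred n<1+N) f≡0) (f≡0 (suc N) n<1+N))
                         (ℚₚ.+-identityʳ (sumTo f n))

-- Formal power series

infixl 6 _⊕_ _⊖_
infixl 7 _•_

_⊕_ : Series → Series → Series
(a ⊕ b) n = a n + b n

_⊖_ : Series → Series → Series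
(a ⊖ b) n = a n - b n

_•_ : ℚ → Series → Series
(c • a) n = c * a n

Order≥ : ℕ → Series → Set
Order≥ k s = ∀ n → n < k → s n ≡ 0ℚ

•-order : ∀ c {k s} → Order≥ k s → Order≥ k (c • s)
•-order c s≡0 n n<k = trans (cong (c *_) (s≡0 n n<k)) (ℚₚ.*-zeroʳ c)

⊛-cong : ∀ {a a′ b b′ : Series} → a ≗ a′ → b ≗ b′ → (a ⊛ b) ≗ (a′ ⊛ b′)
⊛-cong a≗a′ b≗b′ n = sumTo-cong n (λ i → cong₂ _*_ (a≗a′ i) (b≗b′ (n ∸ i)))

⊛-comm : ∀ (a b : Series) → (a ⊛ b) ≗ (b ⊛ a)
⊛-comm a b n = trans (sumTo-reverse (λ i → a i * b (n ∸ i)) n) (sumTo-cong≤ n swap)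
  where
  swap : ∀ i → i ≤ n → a (n ∸ i) * b (n ∸ (n ∸ i)) ≡ b i * a (n ∸ i)
  swap i i≤n = trans (ℚₚ.*-comm (a (n ∸ i)) _) (cong (λ j → b j * a (n ∸ i)) (ℕₚ.m∸[m∸n]≡n i≤n))

⊛-assoc : ∀ (a b c : Series) → ((a ⊛ b) ⊛ c) ≗ (a ⊛ (b ⊛ c))
⊛-assoc a b c n = begin
  sumTo (λ i → sumTo (λ j → a j * b (i ∸ j)) i * c (n ∸ i)) n
    ≡⟨ sumTo-cong≤ n (λ i i≤n → trans (*-distribʳ-sumTo (c (n ∸ i)) _ i) (sumTo-cong≤ i (reindex i))) ⟩
  sumTo (λ i → sumTo (λ j → a j * b (i ∸ j) * c (n ∸ j ∸ (i ∸ j))) i) n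
    ≡⟨ sumTo-triangle (λ j l → a j * b l * c (n ∸ j ∸ l)) n ⟩
  sumTo (λ j → sumTo (λ l → a j * b l * c (n ∸ j ∸ l)) (n ∸ j)) n
    ≡⟨ sumTo-cong n (λ j → trans (sumTo-cong (n ∸ j) (λ l → ℚₚ.*-assoc (a j) (b l) _))
                                 (sym (*-distribˡ-sumTo (a j) _ (n ∸ j)))) ⟩
  sumTo (λ j → a j * sumTo (λ l → b l * c (n ∸ j ∸ l)) (n ∸ j)) n
    ∎
  where
  open ≡-Reasoning
  reindex : ∀ i j → j ≤ i → a j * b (i ∸ j) * c (n ∸ i) ≡ a j * b (i ∸ j) * c (n ∸ j ∸ (i ∸ j))
  reindex i j j≤i = cong (λ m → a j * b (i ∸ j) * c m)
    (sym (trans (ℕₚ.∸-+-assoc n j (i ∸ j)) (cong (n ∸_) (ℕₚ.m+[n∸m]≡n j≤i))))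

⊛-right-comm : ∀ (a b c : Series) → ((a ⊛ b) ⊛ c) ≗ ((a ⊛ c) ⊛ b)
⊛-right-comm a b c n = begin
  ((a ⊛ b) ⊛ c) n   ≡⟨ ⊛-assoc a b c n ⟩
  (a ⊛ (b ⊛ c)) n   ≡⟨ ⊛-cong {a} (λ _ → refl) (⊛-comm b c) n ⟩
  (a ⊛ (c ⊛ b)) n   ≡⟨ sym (⊛-assoc a c b n) ⟩
  ((a ⊛ c) ⊛ b) n   ∎
  where open ≡-Reasoning

⊛-distribʳ-⊕ : ∀ (a b c : Series) → ((a ⊕ b) ⊛ c) ≗ (a ⊛ c) ⊕ (b ⊛ c)
⊛-distribʳ-⊕ a b c n =
  trans (sumTo-cong n (λ i → ℚₚ.*-distribʳ-+ (c (n ∸ i)) (a i) (b i))) (sumTo-distrib-+ _ _ n)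

⊛-•ˡ : ∀ k (a b : Series) → ((k • a) ⊛ b) ≗ k • (a ⊛ b)
⊛-•ˡ k a b n = trans (sumTo-cong n (λ i → ℚₚ.*-assoc k (a i) (b (n ∸ i)))) (sym (*-distribˡ-sumTo k _ n))

⊛-•ʳ : ∀ k (a b : Series) → (a ⊛ (k • b)) ≗ k • (a ⊛ b)
⊛-•ʳ k a b n = begin
  (a ⊛ (k • b)) n   ≡⟨ ⊛-comm a (k • b) n ⟩
  ((k • b) ⊛ a) n   ≡⟨ ⊛-•ˡ k b a n ⟩
  k * (b ⊛ a) n     ≡⟨ cong (k *_) (⊛-comm b a n) ⟩
  k * (a ⊛ b) n     ∎
  where open ≡-Reasoning

⊛-zeroˡ : ∀ {a : Series} (b : Series) → (∀ m → a m ≡ 0ℚ) → ∀ n → (a ⊛ b) n ≡ 0ℚ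
⊛-zeroˡ b a≡0 n = sumTo-zero n (λ i _ → trans (cong (_* b (n ∸ i)) (a≡0 i)) (ℚₚ.*-zeroˡ (b (n ∸ i))))

⊛-suc : ∀ (a b : Series) → a 0 ≡ 0ℚ → ∀ n → (a ⊛ b) (suc n) ≡ ((a ∘ suc) ⊛ b) n
⊛-suc a b a₀≡0 n = begin
  (a ⊛ b) (suc n)                          ≡⟨ sumTo-head (λ i → a i * b (suc n ∸ i)) n ⟩
  a 0 * b (suc n) + ((a ∘ suc) ⊛ b) n      ≡⟨ cong (λ z → z * b (suc n) + ((a ∘ suc) ⊛ b) n) a₀≡0 ⟩
  0ℚ * b (suc n) + ((a ∘ suc) ⊛ b) n       ≡⟨ cong (_+ ((a ∘ suc) ⊛ b) n) (ℚₚ.*-zeroˡ (b (suc n))) ⟩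
  0ℚ + ((a ∘ suc) ⊛ b) n                   ≡⟨ ℚₚ.+-identityˡ _ ⟩
  ((a ∘ suc) ⊛ b) n                        ∎
  where open ≡-Reasoning

⊛-order : ∀ {i j} {a b : Series} → Order≥ i a → Order≥ j b → Order≥ (i ℕ.+ j) (a ⊛ b)
⊛-order {i} {j} {a} {b} a≡0 b≡0 n n<i+j = sumTo-zero n term
  where
  term : ∀ l → l ≤ n → a l * b (n ∸ l) ≡ 0ℚ
  term l l≤n with l ℕₚ.<? i
  ... | yes l<i = trans (cong (_* b (n ∸ l)) (a≡0 l l<i)) (ℚₚ.*-zeroˡ (b (n ∸ l)))
  ... | no  l≮i = trans (cong (a l *_) (b≡0 (n ∸ l) n∸l<j)) (ℚₚ.*-zeroʳ (a l))
    where
    n∸l<j : n ∸ l < j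
    n∸l<j = ℕₚ.+-cancelˡ-< l (n ∸ l) j (begin-strict
      l ℕ.+ (n ∸ l)   ≡⟨ ℕₚ.m+[n∸m]≡n l≤n ⟩
      n               <⟨ n<i+j ⟩
      i ℕ.+ j         ≤⟨ ℕₚ.+-monoˡ-≤ j (ℕₚ.≮⇒≥ l≮i) ⟩
      l ℕ.+ j         ∎)
      where open ℕₚ.≤-Reasoning

-- Σᶠ Q is Σ_k Q k truncated to k ≤ n in degree n, which is the true sum when Q k has order ≥ k.
Σᶠ : (ℕ → Series) → Series
Σᶠ Q n = sumTo (λ k → Q k n) n

module _ {Q : ℕ → Series} (ordered : ∀ k → Order≥ k (Q k)) where

  Σᶠ-extend : ∀ {n N} → n ≤ N → sumTo (λ k → Q k n) N ≡ Σᶠ Q n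
  Σᶠ-extend {n} n≤N = sumTo-extend (λ k → Q k n) n≤N (λ k n<k → ordered k n n<k)

  Σᶠ-⊛ : ∀ (b : Series) n → (Σᶠ Q ⊛ b) n ≡ sumTo (λ k → (Q k ⊛ b) n) n
  Σᶠ-⊛ b n = begin
    sumTo (λ i → Σᶠ Q i * b (n ∸ i)) n
      ≡⟨ sumTo-cong≤ n (λ i i≤n → cong (_* b (n ∸ i)) (sym (Σᶠ-extend i≤n))) ⟩
    sumTo (λ i → sumTo (λ k → Q k i) n * b (n ∸ i)) n
      ≡⟨ sumTo-cong n (λ i → *-distribʳ-sumTo (b (n ∸ i)) (λ k → Q k i) n) ⟩
    sumTo (λ i → sumTo (λ k → Q k i * b (n ∸ i)) n) n
      ≡⟨ sumTo-swap (λ i k → Q k i * b (n ∸ i)) n n ⟩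
    sumTo (λ k → (Q k ⊛ b) n) n
      ∎
    where open ≡-Reasoning

-- Derivations

-- θ = t d/dt and ∂ lam = (1 + lam t) d/dt.
θ : Series → Series
θ s n = ℕ→ℚ n * s n

∂ : ℚ → Series → Series
∂ lam s = (θ s ∘ suc) ⊕ lam • θ s

θ-Leibniz : ∀ (a b : Series) → θ (a ⊛ b) ≗ (θ a ⊛ b) ⊕ (a ⊛ θ b)
θ-Leibniz a b n = begin
  ℕ→ℚ n * sumTo (λ i → a i * b (n ∸ i)) n
    ≡⟨ *-distribˡ-sumTo (ℕ→ℚ n) _ n ⟩
  sumTo (λ i → ℕ→ℚ n * (a i * b (n ∸ i))) n
    ≡⟨ sumTo-cong≤ n split ⟩
  sumTo (λ i → θ a i * b (n ∸ i) + a i * θ b (n ∸ i)) n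
    ≡⟨ sumTo-distrib-+ _ _ n ⟩
  (θ a ⊛ b) n + (a ⊛ θ b) n
    ∎
  where
  open ≡-Reasoning
  split : ∀ i → i ≤ n → ℕ→ℚ n * (a i * b (n ∸ i)) ≡ θ a i * b (n ∸ i) + a i * θ b (n ∸ i)
  split i i≤n = begin
    ℕ→ℚ n * (a i * b (n ∸ i))
      ≡⟨ cong (λ m → ℕ→ℚ m * (a i * b (n ∸ i))) (sym (ℕₚ.m+[n∸m]≡n i≤n)) ⟩
    ℕ→ℚ (i ℕ.+ (n ∸ i)) * (a i * b (n ∸ i))
      ≡⟨ cong (_* (a i * b (n ∸ i))) (ℕ→ℚ-+ i (n ∸ i)) ⟩
    (ℕ→ℚ i + ℕ→ℚ (n ∸ i)) * (a i * b (n ∸ i))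
      ≡⟨ solve 4 (λ k l x y → (k :+ l) :* (x :* y) := k :* x :* y :+ x :* (l :* y)) refl
           (ℕ→ℚ i) (ℕ→ℚ (n ∸ i)) (a i) (b (n ∸ i)) ⟩
    θ a i * b (n ∸ i) + a i * θ b (n ∸ i)
      ∎

θ-⊛-suc : ∀ (a b : Series) n → (θ a ⊛ b) (suc n) ≡ ((θ a ∘ suc) ⊛ b) n
θ-⊛-suc a b = ⊛-suc (θ a) b (ℚₚ.*-zeroˡ (a 0))

∂-Leibniz : ∀ lam (a b : Series) → ∂ lam (a ⊛ b) ≗ (∂ lam a ⊛ b) ⊕ (a ⊛ ∂ lam b)
∂-Leibniz lam a b n = begin
  θ (a ⊛ b) (suc n) + lam * θ (a ⊛ b) n
    ≡⟨ cong₂ (λ u v → u + lam * v) (θ-Leibniz a b (suc n)) (θ-Leibniz a b n) ⟩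
  ((θ a ⊛ b) (suc n) + (a ⊛ θ b) (suc n)) + lam * ((θ a ⊛ b) n + (a ⊛ θ b) n)
    ≡⟨ cong₂ (λ u v → (u + v) + lam * ((θ a ⊛ b) n + (a ⊛ θ b) n))
             (θ-⊛-suc a b n) (trans (⊛-comm a (θ b) (suc n)) (θ-⊛-suc b a n)) ⟩
  (Da + Db) + lam * ((θ a ⊛ b) n + (a ⊛ θ b) n)
    ≡⟨ cong (λ v → (Da + Db) + lam * ((θ a ⊛ b) n + v)) (⊛-comm a (θ b) n) ⟩
  (Da + Db) + lam * ((θ a ⊛ b) n + (θ b ⊛ a) n)
    ≡⟨ solve 5 (λ l w x y z → (w :+ x) :+ l :* (y :+ z) := (w :+ l :* y) :+ (x :+ l :* z)) refl
         lam Da Db ((θ a ⊛ b) n) ((θ b ⊛ a) n) ⟩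
  (Da + lam * (θ a ⊛ b) n) + (Db + lam * (θ b ⊛ a) n)
    ≡⟨ sym (cong₂ _+_ (∂-⊛ a b) (∂-⊛ b a)) ⟩
  (∂ lam a ⊛ b) n + (∂ lam b ⊛ a) n
    ≡⟨ cong (λ z → (∂ lam a ⊛ b) n + z) (⊛-comm (∂ lam b) a n) ⟩
  (∂ lam a ⊛ b) n + (a ⊛ ∂ lam b) n
    ∎
  where
  open ≡-Reasoning
  Da = ((θ a ∘ suc) ⊛ b) n
  Db = ((θ b ∘ suc) ⊛ a) n
  ∂-⊛ : ∀ (c d : Series) → (∂ lam c ⊛ d) n ≡ ((θ c ∘ suc) ⊛ d) n + lam * (θ c ⊛ d) n
  ∂-⊛ c d = trans (⊛-distribʳ-⊕ (θ c ∘ suc) (lam • θ c) d n)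
                  (cong (λ z → ((θ c ∘ suc) ⊛ d) n + z) (⊛-•ˡ lam (θ c) d n))

∂-cong : ∀ lam {a b : Series} → a ≗ b → ∂ lam a ≗ ∂ lam b
∂-cong lam a≗b n = cong₂ (λ u v → ℕ→ℚ (suc n) * u + lam * (ℕ→ℚ n * v)) (a≗b (suc n)) (a≗b n)

∂-• : ∀ lam c (a : Series) → ∂ lam (c • a) ≗ c • ∂ lam a
∂-• lam c a n =
  solve 6 (λ l c s t x y → s :* (c :* x) :+ l :* (t :* (c :* y)) := c :* (s :* x :+ l :* (t :* y))) refl
    lam c (ℕ→ℚ (suc n)) (ℕ→ℚ n) (a (suc n)) (a n)

∂-Σᶠ : ∀ lam {Q : ℕ → Series} → (∀ k → Order≥ k (Q k)) →
       ∀ n → ∂ lam (Σᶠ Q) n ≡ sumTo (λ k → ∂ lam (Q k) n) (suc n)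
∂-Σᶠ lam {Q} ordered n = begin
  ℕ→ℚ (suc n) * Σᶠ Q (suc n) + lam * (ℕ→ℚ n * Σᶠ Q n)
    ≡⟨ cong (λ s → ℕ→ℚ (suc n) * Σᶠ Q (suc n) + lam * (ℕ→ℚ n * s))
            (sym (Σᶠ-extend ordered (ℕₚ.n≤1+n n))) ⟩
  ℕ→ℚ (suc n) * Σᶠ Q (suc n) + lam * (ℕ→ℚ n * sumTo (λ k → Q k n) (suc n))
    ≡⟨ cong₂ _+_ (*-distribˡ-sumTo (ℕ→ℚ (suc n)) _ (suc n))
                 (trans (cong (lam *_) (*-distribˡ-sumTo (ℕ→ℚ n) _ (suc n)))
                        (*-distribˡ-sumTo lam _ (suc n))) ⟩
  sumTo (λ k → θ (Q k) (suc n)) (suc n) + sumTo (λ k → lam * θ (Q k) n) (suc n)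
    ≡⟨ sym (sumTo-distrib-+ _ _ (suc n)) ⟩
  sumTo (λ k → ∂ lam (Q k) n) (suc n)
    ∎
  where open ≡-Reasoning

!-⊛ : ∀ (a b : Series) n →
      ℕ→ℚ (n !) * (a ⊛ b) n
        ≡ sumTo (λ j → ℕ→ℚ (n C j) * (ℕ→ℚ (j !) * a j) * (ℕ→ℚ ((n ∸ j) !) * b (n ∸ j))) n
!-⊛ a b n = trans (*-distribˡ-sumTo (ℕ→ℚ (n !)) _ n) (sumTo-cong≤ n term)
  where
  term : ∀ j → j ≤ n → ℕ→ℚ (n !) * (a j * b (n ∸ j))
                     ≡ ℕ→ℚ (n C j) * (ℕ→ℚ (j !) * a j) * (ℕ→ℚ ((n ∸ j) !) * b (n ∸ j))
  term j j≤n = trans (cong (_* (a j * b (n ∸ j))) (sym (binomial-ℕ→ℚ j≤n)))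
    (solve 5 (λ c f g x y → c :* (f :* g) :* (x :* y) := c :* (f :* x) :* (g :* y)) refl
       (ℕ→ℚ (n C j)) (ℕ→ℚ (j !)) (ℕ→ℚ ((n ∸ j) !)) (a j) (b (n ∸ j)))

-- Degenerate exponentials and substitution into e_λ(t) - 1

derivative : (ℕ → ℚ) → (ℕ → ℚ)
derivative a k = ℕ→ℚ (suc k) * a (suc k)

module _ (lam : ℚ) where

  private
    E : Series
    E = eλ-1 lam

    e : Series
    e = eλx lam 1ℚ

  ∂-eλx : ∀ y → ∂ lam (eλx lam y) ≗ y • eλx lam y
  ∂-eλx y m = begin
    S * (F * (y - K * lam) * I′) + lam * (K * (F * inv! m))
      ≡⟨ cong (λ i → S * (F * (y - K * lam) * I′) + lam * (K * (F * i))) (sym (inv!-suc m)) ⟩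
    S * (F * (y - K * lam) * I′) + lam * (K * (F * (S * I′)))
      ≡⟨ solve 6 (λ s f y k l i → s :* (f :* (y :- k :* l) :* i) :+ l :* (k :* (f :* (s :* i)))
                                   := y :* (f :* (s :* i))) refl S F y K lam I′ ⟩
    y * (F * (S * I′))
      ≡⟨ cong (λ i → y * (F * i)) (inv!-suc m) ⟩
    y * (F * inv! m)
      ∎
    where
    open ≡-Reasoning
    F  = fallingλ lam y m
    S  = ℕ→ℚ (suc m)
    K  = ℕ→ℚ m
    I′ = inv! (suc m)

  !-eλx : ∀ y m → ℕ→ℚ (m !) * eλx lam y m ≡ fallingλ lam y m
  !-eλx y m = begin
    ℕ→ℚ (m !) * (F * inv! m)   ≡⟨ solve 3 (λ g f i → g :* (f :* i) := f :* (i :* g)) refl (ℕ→ℚ (m !)) F (inv! m) ⟩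
    F * (inv! m * ℕ→ℚ (m !))   ≡⟨ cong (F *_) (inv!-inverse m) ⟩
    F * 1ℚ                     ≡⟨ ℚₚ.*-identityʳ F ⟩
    F                          ∎
    where
    open ≡-Reasoning
    F = fallingλ lam y m

  ∂-one : ∀ m → ∂ lam one m ≡ 0ℚ
  ∂-one m = trans (cong₂ (λ u v → u + lam * v) (θ-one (suc m)) (θ-one m))
                  (solve 1 (λ l → con 0ℚ :+ l :* con 0ℚ := con 0ℚ) refl lam)
    where
    θ-one : ∀ m → θ one m ≡ 0ℚ
    θ-one zero    = refl
    θ-one (suc m) = ℚₚ.*-zeroʳ (ℕ→ℚ (suc m))

  -- e_λ(t) - 1 and e_λ(t) differ only in the constant term, which θ does not see.
  ∂-eλ-1 : ∂ lam E ≗ e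
  ∂-eλ-1 m = begin
    θ E (suc m) + lam * θ E m   ≡⟨ cong (λ u → θ E (suc m) + lam * u) (θE≗θe m) ⟩
    ∂ lam e m                   ≡⟨ ∂-eλx 1ℚ m ⟩
    1ℚ * e m                    ≡⟨ ℚₚ.*-identityˡ (e m) ⟩
    e m                         ∎
    where
    open ≡-Reasoning
    θE≗θe : θ E ≗ θ e
    θE≗θe zero    = refl
    θE≗θe (suc m) = refl

  ∂-pow-eλ-1 : ∀ k → ∂ lam (pow E (suc k)) ≗ ℕ→ℚ (suc k) • (pow E k ⊛ e)
  ∂-pow-eλ-1 k n = begin
    ∂ lam (pow E k ⊛ E) n
      ≡⟨ ∂-Leibniz lam (pow E k) E n ⟩
    (∂ lam (pow E k) ⊛ E) n + (pow E k ⊛ ∂ lam E) n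
      ≡⟨ cong₂ _+_ (first k) (⊛-cong {pow E k} (λ _ → refl) ∂-eλ-1 n) ⟩
    ℕ→ℚ k * (pow E k ⊛ e) n + (pow E k ⊛ e) n
      ≡⟨ solve 2 (λ c s → c :* s :+ s := (con 1ℚ :+ c) :* s) refl (ℕ→ℚ k) ((pow E k ⊛ e) n) ⟩
    (1ℚ + ℕ→ℚ k) * (pow E k ⊛ e) n
      ≡⟨ cong (_* (pow E k ⊛ e) n) (sym (ℕ→ℚ-+ 1 k)) ⟩
    ℕ→ℚ (suc k) * (pow E k ⊛ e) n
      ∎
    where
    open ≡-Reasoning
    first : ∀ k → (∂ lam (pow E k) ⊛ E) n ≡ ℕ→ℚ k * (pow E k ⊛ e) n
    first zero    = trans (⊛-zeroˡ E ∂-one n) (sym (ℚₚ.*-zeroˡ ((pow E 0 ⊛ e) n)))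
    first (suc j) = begin
      (∂ lam (pow E (suc j)) ⊛ E) n
        ≡⟨ ⊛-cong {b = E} (∂-pow-eλ-1 j) (λ _ → refl) n ⟩
      ((ℕ→ℚ (suc j) • (pow E j ⊛ e)) ⊛ E) n
        ≡⟨ ⊛-•ˡ (ℕ→ℚ (suc j)) (pow E j ⊛ e) E n ⟩
      ℕ→ℚ (suc j) * ((pow E j ⊛ e) ⊛ E) n
        ≡⟨ cong (ℕ→ℚ (suc j) *_) (⊛-right-comm (pow E j) e E n) ⟩
      ℕ→ℚ (suc j) * (pow E (suc j) ⊛ e) n
        ∎

  pow-eλ-1-order : ∀ k → Order≥ k (pow E k)
  pow-eλ-1-order zero    n ()
  pow-eλ-1-order (suc k) = subst (λ i → Order≥ i (pow E (suc k))) (ℕₚ.+-comm k 1)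
                                 (⊛-order (pow-eλ-1-order k) E-order)
    where
    E-order : Order≥ 1 E
    E-order zero    _         = refl
    E-order (suc n) (s≤s ())

  -- f(e_λ(t) - 1) for the power series f(u) = Σ a k u^k
  substEλ : (ℕ → ℚ) → Series
  substEλ a = Σᶠ (λ k → a k • pow E k)

  substEλ-ordered : ∀ (a : ℕ → ℚ) k → Order≥ k (a k • pow E k)
  substEλ-ordered a k = •-order (a k) (pow-eλ-1-order k)

  substEλ-⊛ : ∀ a (b : Series) n → (substEλ a ⊛ b) n ≡ sumTo (λ k → a k * (pow E k ⊛ b) n) n
  substEλ-⊛ a b n = trans (Σᶠ-⊛ (substEλ-ordered a) b n) (sumTo-cong n (λ k → ⊛-•ˡ (a k) (pow E k) b n))

  ∂-substEλ : ∀ a → ∂ lam (substEλ a) ≗ substEλ (derivative a) ⊛ e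
  ∂-substEλ a n = begin
    ∂ lam (substEλ a) n
      ≡⟨ ∂-Σᶠ lam (substEλ-ordered a) n ⟩
    sumTo (λ k → ∂ lam (a k • pow E k) n) (suc n)
      ≡⟨ sumTo-cong (suc n) (λ k → ∂-• lam (a k) (pow E k) n) ⟩
    sumTo (λ k → a k * ∂ lam (pow E k) n) (suc n)
      ≡⟨ sumTo-head _ n ⟩
    a 0 * ∂ lam one n + sumTo (λ k → a (suc k) * ∂ lam (pow E (suc k)) n) n
      ≡⟨ cong₂ _+_ (trans (cong (a 0 *_) (∂-one n)) (ℚₚ.*-zeroʳ (a 0)))
                   (sumTo-cong n (λ k → cong (a (suc k) *_) (∂-pow-eλ-1 k n))) ⟩
    0ℚ + sumTo (λ k → a (suc k) * (ℕ→ℚ (suc k) * (pow E k ⊛ e) n)) n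
      ≡⟨ trans (ℚₚ.+-identityˡ _) (sumTo-cong n (λ k → sym (ℚₚ.*-assoc (a (suc k)) _ _))) ⟩
    sumTo (λ k → a (suc k) * ℕ→ℚ (suc k) * (pow E k ⊛ e) n) n
      ≡⟨ sumTo-cong n (λ k → cong (_* (pow E k ⊛ e) n) (ℚₚ.*-comm (a (suc k)) (ℕ→ℚ (suc k)))) ⟩
    sumTo (λ k → derivative a k * (pow E k ⊛ e) n) n
      ≡⟨ sym (substEλ-⊛ (derivative a) e n) ⟩
    (substEλ (derivative a) ⊛ e) n
      ∎
    where open ≡-Reasoning

-- Truncated degenerate modified Bell polynomials

-- The coefficients p!/(k+p)! of f_p(u) = p!/u^p (e^u - Σ_{l<p} u^l/l!).
bellCoeff : ℕ → ℕ → ℚ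
bellCoeff p k = ℕ→ℚ (p !) * inv! (k ℕ.+ p)

derivative-bellCoeff : ∀ p k →
  derivative (bellCoeff p) k ≡ bellCoeff p k - ((+ p) / suc p) * bellCoeff (suc p) k
derivative-bellCoeff p k = sym (begin
  F * inv! (k ℕ.+ p) - π * (ℕ→ℚ (suc p ℕ.* p !) * inv! (k ℕ.+ suc p))
    ≡⟨ cong₂ (λ u v → F * u - π * v) (sym (inv!-suc (k ℕ.+ p)))
             (cong₂ _*_ (ℕ→ℚ-* (suc p) (p !)) (cong inv! (ℕₚ.+-suc k p))) ⟩
  F * (ℕ→ℚ (suc k ℕ.+ p) * I) - π * (S * F * I)
    ≡⟨ cong (λ u → F * (u * I) - π * (S * F * I)) (ℕ→ℚ-+ (suc k) p) ⟩
  F * ((K + P) * I) - π * (S * F * I)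
    ≡⟨ solve 6 (λ f k p i π s → f :* ((k :+ p) :* i) :- π :* (s :* f :* i)
                              := f :* ((k :+ p) :* i) :- π :* s :* f :* i) refl F K P I π S ⟩
  F * ((K + P) * I) - π * S * F * I
    ≡⟨ cong (λ u → F * ((K + P) * I) - u * F * I) (/-*-cancel p (suc p)) ⟩
  F * ((K + P) * I) - P * F * I
    ≡⟨ solve 4 (λ f k p i → f :* ((k :+ p) :* i) :- p :* f :* i := k :* (f :* i)) refl F K P I ⟩
  K * (F * I)
    ∎)
  where
  open ≡-Reasoning
  F = ℕ→ℚ (p !)
  I = inv! (suc (k ℕ.+ p))
  K = ℕ→ℚ (suc k)
  P = ℕ→ℚ p
  S = ℕ→ℚ (suc p)
  π = (+ p) / suc p

module _ (lam x : ℚ) where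

  private
    F : ℕ → Series
    F p = bellSeries p lam x

    X : Series
    X = eλx lam x

    e : Series
    e = eλx lam 1ℚ

    π : ℕ → ℚ
    π p = (+ p) / suc p

  bellSeries-substEλ : ∀ p → F p ≗ substEλ lam (bellCoeff p) ⊛ X
  bellSeries-substEλ p n = sym (substEλ-⊛ lam (bellCoeff p) X n)

  substEλ-derivative-bellCoeff : ∀ p →
    substEλ lam (derivative (bellCoeff p)) ⊛ X ≗ F p ⊖ π p • F (suc p)
  substEλ-derivative-bellCoeff p n = begin
    (substEλ lam (derivative (bellCoeff p)) ⊛ X) n
      ≡⟨ substEλ-⊛ lam (derivative (bellCoeff p)) X n ⟩
    sumTo (λ k → derivative (bellCoeff p) k * P k) n
      ≡⟨ sumTo-cong n (λ k → cong (_* P k) (derivative-bellCoeff p k)) ⟩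
    sumTo (λ k → (bellCoeff p k - π p * bellCoeff (suc p) k) * P k) n
      ≡⟨ sumTo-cong n (λ k → solve 4 (λ c π c′ q → (c :- π :* c′) :* q := c :* q :- π :* (c′ :* q)) refl
                                     (bellCoeff p k) (π p) (bellCoeff (suc p) k) (P k)) ⟩
    sumTo (λ k → bellCoeff p k * P k - π p * (bellCoeff (suc p) k * P k)) n
      ≡⟨ sumTo-distrib-- _ _ n ⟩
    F p n - sumTo (λ k → π p * (bellCoeff (suc p) k * P k)) n
      ≡⟨ cong (λ z → F p n - z) (sym (*-distribˡ-sumTo (π p) _ n)) ⟩
    F p n - π p * F (suc p) n
      ∎
    where
    open ≡-Reasoning
    P : ℕ → ℚ
    P k = (pow (eλ-1 lam) k ⊛ X) n

  ∂-bellSeries : ∀ p → ∂ lam (F p) ≗ x • F p ⊕ ((F p ⊖ π p • F (suc p)) ⊛ e)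
  ∂-bellSeries p n = begin
    ∂ lam (F p) n
      ≡⟨ ∂-cong lam (bellSeries-substEλ p) n ⟩
    ∂ lam (A ⊛ X) n
      ≡⟨ ∂-Leibniz lam A X n ⟩
    (∂ lam A ⊛ X) n + (A ⊛ ∂ lam X) n
      ≡⟨ cong₂ _+_ (⊛-cong {b = X} (∂-substEλ lam (bellCoeff p)) (λ _ → refl) n)
                   (trans (⊛-cong {A} (λ _ → refl) (∂-eλx lam x) n) (⊛-•ʳ x A X n)) ⟩
    ((A′ ⊛ e) ⊛ X) n + x * (A ⊛ X) n
      ≡⟨ cong₂ _+_ (trans (⊛-right-comm A′ e X n)
                          (⊛-cong {b = e} (substEλ-derivative-bellCoeff p) (λ _ → refl) n))
                   (cong (x *_) (sym (bellSeries-substEλ p n))) ⟩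
    ((F p ⊖ π p • F (suc p)) ⊛ e) n + x * F p n
      ≡⟨ ℚₚ.+-comm (((F p ⊖ π p • F (suc p)) ⊛ e) n) (x * F p n) ⟩
    x * F p n + ((F p ⊖ π p • F (suc p)) ⊛ e) n
      ∎
    where
    open ≡-Reasoning
    A  = substEλ lam (bellCoeff p)
    A′ = substEλ lam (derivative (bellCoeff p))

  bellDifference : ℕ → ℕ → ℚ
  bellDifference p j = π p * B (suc p) j lam x - B p j lam x

  bellSeries-!-⊛-eλ : ∀ p n →
    ℕ→ℚ (n !) * ((F p ⊖ π p • F (suc p)) ⊛ e) n
      ≡ - sumTo (λ j → ℕ→ℚ (n C j) * fallingλ lam 1ℚ (n ∸ j) * bellDifference p j) n
  bellSeries-!-⊛-eλ p n = begin
    ℕ→ℚ (n !) * ((F p ⊖ π p • F (suc p)) ⊛ e) n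
      ≡⟨ !-⊛ (F p ⊖ π p • F (suc p)) e n ⟩
    sumTo (λ j → ℕ→ℚ (n C j) * (ℕ→ℚ (j !) * (F p j - π p * F (suc p) j)) * (ℕ→ℚ ((n ∸ j) !) * e (n ∸ j))) n
      ≡⟨ sumTo-cong n term ⟩
    sumTo (λ j → - (ℕ→ℚ (n C j) * fallingλ lam 1ℚ (n ∸ j) * bellDifference p j)) n
      ≡⟨ sumTo-neg _ n ⟩
    - sumTo (λ j → ℕ→ℚ (n C j) * fallingλ lam 1ℚ (n ∸ j) * bellDifference p j) n
      ∎
    where
    open ≡-Reasoning
    term : ∀ j → ℕ→ℚ (n C j) * (ℕ→ℚ (j !) * (F p j - π p * F (suc p) j)) * (ℕ→ℚ ((n ∸ j) !) * e (n ∸ j))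
               ≡ - (ℕ→ℚ (n C j) * fallingλ lam 1ℚ (n ∸ j) * bellDifference p j)
    term j = trans (cong (λ u → ℕ→ℚ (n C j) * (ℕ→ℚ (j !) * (F p j - π p * F (suc p) j)) * u)
                         (!-eλx lam 1ℚ (n ∸ j)))
      (solve 6 (λ c g f f′ π u → c :* (g :* (f :- π :* f′)) :* u := :- (c :* u :* (π :* (g :* f′) :- g :* f)))
         refl (ℕ→ℚ (n C j)) (ℕ→ℚ (j !)) (F p j) (F (suc p) j) (π p) (fallingλ lam 1ℚ (n ∸ j)))

theorem16 : (lam x : ℚ) (n p : ℕ) →
    B p (suc n) lam x ≡
      (x - ℕ→ℚ n * lam) * B p n lam x
      - sumTo (λ j → ℕ→ℚ (n C j) * fallingλ lam 1ℚ (n ∸ j)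
                       * (((+ p) / suc p) * B (suc p) j lam x - B p j lam x)) n
theorem16 lam x n p = begin
  ℕ→ℚ (suc n ℕ.* n !) * F (suc n)
    ≡⟨ cong (_* F (suc n)) (ℕ→ℚ-* (suc n) (n !)) ⟩
  ℕ→ℚ (suc n) * ℕ→ℚ (n !) * F (suc n)
    ≡⟨ solve 5 (λ s f u l t → s :* f :* u := f :* ((s :* u :+ l :* t) :- l :* t)) refl
         (ℕ→ℚ (suc n)) (ℕ→ℚ (n !)) (F (suc n)) lam (θ F n) ⟩
  ℕ→ℚ (n !) * (∂ lam F n - lam * θ F n)
    ≡⟨ cong (λ d → ℕ→ℚ (n !) * (d - lam * θ F n)) (∂-bellSeries lam x p n) ⟩
  ℕ→ℚ (n !) * ((x * F n + (G ⊛ eλx lam 1ℚ) n) - lam * (ℕ→ℚ n * F n))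
    ≡⟨ solve 6 (λ f x u g l k → f :* ((x :* u :+ g) :- l :* (k :* u)) := (x :- k :* l) :* (f :* u) :+ f :* g)
         refl (ℕ→ℚ (n !)) x (F n) ((G ⊛ eλx lam 1ℚ) n) lam (ℕ→ℚ n) ⟩
  (x - ℕ→ℚ n * lam) * B p n lam x + ℕ→ℚ (n !) * (G ⊛ eλx lam 1ℚ) n
    ≡⟨ cong (λ z → (x - ℕ→ℚ n * lam) * B p n lam x + z) (bellSeries-!-⊛-eλ lam x p n) ⟩
  (x - ℕ→ℚ n * lam) * B p n lam x
    - sumTo (λ j → ℕ→ℚ (n C j) * fallingλ lam 1ℚ (n ∸ j) * bellDifference lam x p j) n
    ∎
  where
  open ≡-Reasoning
  F : Series
  F = bellSeries p lam x
  G : Series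
  G = F ⊖ ((+ p) / suc p) • bellSeries (suc p) lam x
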